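{- Let $T$ be a standard Young tableau with three rows, and consider its oriented $\mathsf{m}$-diagram. Let $v$ be a point where two arcs cross (a 4-valent interior vertex). There is a unique way to replace $v$ by two trivalent vertices joined by a directed edge, leaving the diagram unchanged outside a small neighborhood of $v$, such that each of the two new vertices is a source (all incident edges directed out) or a sink (all incident edges directed in).
   Context: Tableau conventions: rows are left-justified and numbered from the bottom; a standard Young tableau with $N$ boxes is a filling by $1,\dots,N$, each once, increasing left to right along rows and bottom to top along columns. $\mathsf{m}$-diagram: place points $1,\dots,N$ in order on a horizontal line $\ell$; for $i=1,\dots,N$ in increasing order, if $i$ lies in row $r+1$ ($r\ge 1$), join $i$ by an arc (upper semicircle with diameter $[j,i]$) to the largest entry $j<i$ of row $r$ not already joined by an arc to an entry of row $r+1$. An $\mathsf{m}$ is a triple $i<j<k$ with arcs $(i,j),(j,k)$ and no other arcs at $i,j,k$; an isolated arc is an arc which is the only arc at either endpoint. Oriented $\mathsf{m}$-diagram: for each $\mathsf{m}$ $(i,j,k)$ the two arcs are made to meet at a trivalent interior vertex just above $j$, joined to boundary point $j$ by a short edge; each edge of an $\mathsf{m}$ is directed away from the boundary toward this trivalent vertex, each arc keeping its direction through crossings with other arcs; each isolated arc is directed from its row-1 endpoint to its row-2 endpoint. Thus at a crossing point of two arcs there are two incoming and two outgoing half-edges. -}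

module Defs where

open import Data.Nat using (ℕ; zero; suc; _<_; _⊔_; _<ᵇ_)
open import Data.Nat.Properties using (_≟_)
open import Data.Bool using (Bool; true; false; _∧_; not)
open import Data.List using (List; []; _∷_; _++_; [_]; length; foldl; foldr; applyUpTo; filterᵇ)
open import Data.Bool.ListAction using (any)
open import Data.List.Relation.Unary.Linked using (Linked)
open import Data.List.Relation.Binary.Permutation.Propositional using (_↭_)
open import Data.List.Membership.Propositional using (_∈_)
open import Data.List.Membership.DecPropositional _≟_ using (_∈?_)
open import Data.Maybe using (Maybe; just; nothing; maybe)
open import Data.Product using (_×_; _,_; proj₁; proj₂)
open import Data.Sum using (_⊎_)
open import Data.Unit using (⊤)
open import Data.Empty using (⊥)
open import Relation.Nullary using (yes; no; ¬_)
open import Relation.Nullary.Decidable using (⌊_⌋)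
open import Relation.Binary.PropositionalEquality using (_≡_; _≢_)

-- Standard Young tableaux with three rows.
-- A tableau is given by its rows (row 1 = bottom row, the longest),
-- each listed left to right.

ColumnAbove : List ℕ → List ℕ → Set
ColumnAbove lower        []       = ⊤
ColumnAbove []           (_ ∷ _)  = ⊥
ColumnAbove (x ∷ lower)  (y ∷ up) = x < y × ColumnAbove lower up

record SYT3 (N : ℕ) : Set where
  field
    row₁ row₂ row₃ : List ℕ
    inc₁ : Linked _<_ row₁
    inc₂ : Linked _<_ row₂
    inc₃ : Linked _<_ row₃
    col₁₂ : ColumnAbove row₁ row₂
    col₂₃ : ColumnAbove row₂ row₃
    threeRows : 0 < length row₃
    filling : (row₁ ++ row₂ ++ row₃) ↭ applyUpTo suc N

open SYT3 public

-- The m-diagram. An arc is recorded as (left endpoint , right endpoint).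

Arc : Set
Arc = ℕ × ℕ

-- j is already joined by an arc to an entry of the next row up
-- (such an arc has j as its left endpoint).
joinedUp : List Arc → ℕ → Bool
joinedUp A j = any (λ α → ⌊ proj₁ α ≟ j ⌋) A

maxMaybe : List ℕ → Maybe ℕ
maxMaybe = foldr (λ x m → just (maybe (x ⊔_) x m)) nothing

joinTo : List ℕ → List Arc → ℕ → List Arc
joinTo rowr A i with maxMaybe (filterᵇ (λ j → (j <ᵇ i) ∧ not (joinedUp A j)) rowr)
... | nothing = A
... | just j  = A ++ [ (j , i) ]

step : ∀ {N} → SYT3 N → List Arc → ℕ → List Arc
step T A i with i ∈? row₂ T
... | yes _ = joinTo (row₁ T) A i
... | no _ with i ∈? row₃ T
...   | yes _ = joinTo (row₂ T) A i
...   | no _  = A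

arcs : ∀ {N} → SYT3 N → List Arc
arcs {N} T = foldl (step T) [] (applyUpTo suc N)

Touches : Arc → ℕ → Set
Touches α x = proj₁ α ≡ x ⊎ proj₂ α ≡ x

IsM : ∀ {N} → SYT3 N → ℕ → ℕ → ℕ → Set
IsM T i j k =
  i < j × j < k × (i , j) ∈ arcs T × (j , k) ∈ arcs T ×
  (∀ β → β ∈ arcs T → (Touches β i ⊎ Touches β j ⊎ Touches β k) →
     β ≡ (i , j) ⊎ β ≡ (j , k))

Isolated : ∀ {N} → SYT3 N → Arc → Set
Isolated T α =
  α ∈ arcs T ×
  (∀ β → β ∈ arcs T → Touches β (proj₁ α) → β ≡ α) ×
  (∀ β → β ∈ arcs T → Touches β (proj₂ α) → β ≡ α)

-- Head T α h : in the oriented m-diagram, the arc α is directed towards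
-- its endpoint h (for an m, towards the trivalent vertex above j).
data Head {N} (T : SYT3 N) : Arc → ℕ → Set where
  m-left  : ∀ {i j k} → IsM T i j k → Head T (i , j) j
  m-right : ∀ {i j k} → IsM T i j k → Head T (j , k) j
  iso₁₂   : ∀ {a b} → Isolated T (a , b) → a ∈ row₁ T → b ∈ row₂ T → Head T (a , b) b
  iso₂₁   : ∀ {a b} → Isolated T (a , b) → b ∈ row₁ T → a ∈ row₂ T → Head T (a , b) a

-- Two arcs (a,b), (c,d) (semicircles over [a,b], [c,d]) cross iff a < c < b < d.
Cross : ∀ {N} → SYT3 N → Arc → Arc → Set
Cross T (a , b) (c , d) =
  (a , b) ∈ arcs T × (c , d) ∈ arcs T × a < c × c < b × b < d

-- Local picture at a crossing v of (a,b) and (c,d), a < c < b < d.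
-- Half-edges at v in counterclockwise order:
--   h₀ towards d, h₁ towards a, h₂ towards c, h₃ towards b.

data HE : Set where
  h₀ h₁ h₂ h₃ : HE

module Crossing (a b c d hα hβ : ℕ) where
  endpoint : HE → ℕ
  endpoint h₀ = d
  endpoint h₁ = a
  endpoint h₂ = c
  endpoint h₃ = b

  arcHead : HE → ℕ
  arcHead h₀ = hβ
  arcHead h₁ = hα
  arcHead h₂ = hβ
  arcHead h₃ = hα

  -- directed out of v (towards its endpoint) / into v
  Out In : HE → Set
  Out e = endpoint e ≡ arcHead e
  In  e = endpoint e ≢ arcHead e

  -- By planarity, each new vertex receives two cyclically
  -- consecutive half-edges: pairing p₀₁ gives {h₀,h₁} | {h₂,h₃},
  -- pairing p₁₂ gives {h₁,h₂} | {h₃,h₀}.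
  data Pairing : Set where
    p₀₁ p₁₂ : Pairing

  data Block : Set where
    A B : Block

  record Resolution : Set where
    constructor res
    field
      pairing : Pairing
      newHead : Block     -- the new edge is directed into this block's vertex
  open Resolution public

  halfEdges : Pairing → Block → HE × HE
  halfEdges p₀₁ A = h₀ , h₁
  halfEdges p₀₁ B = h₂ , h₃
  halfEdges p₁₂ A = h₁ , h₂
  halfEdges p₁₂ B = h₃ , h₀

  Sink Source : Resolution → Block → Set
  Sink r X = In (proj₁ (halfEdges (pairing r) X)) ×
             In (proj₂ (halfEdges (pairing r) X)) × newHead r ≡ X
  Source r X = Out (proj₁ (halfEdges (pairing r) X)) ×
               Out (proj₂ (halfEdges (pairing r) X)) × newHead r ≢ X

  Good : Resolution → Set
  Good r = (Source r A ⊎ Sink r A) × (Source r B ⊎ Sink r B)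

module Submission where

-- In the oriented m-diagram every arc is
-- directed towards one of its own endpoints, so of the two half-edges of
-- each arc exactly one points out of v.  Hence v has two outgoing and two
-- incoming half-edges, and the outgoing ones are cyclically adjacent.
-- A resolution is good exactly when one new vertex is a source receiving
-- the two outgoing half-edges (which fixes the pairing) and the other is a
-- sink receiving the two incoming ones and the new edge (which fixes the
-- direction of the new edge); every other resolution puts an incoming and
-- an outgoing half-edge at the same vertex.

open import Defs
open import Data.Nat using (ℕ)
open import Data.Nat.Properties using (<⇒≢; <-trans)
open import Data.Product using (_,_; ∃!; _×_)
open import Data.Sum using (_⊎_; inj₁; inj₂)
open import Data.Empty using (⊥-elim)
open import Relation.Binary.PropositionalEquality using (_≡_; _≢_; refl; sym)

headIsEndpoint : ∀ {N} {T : SYT3 N} {x y h : ℕ} →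
  Head T (x , y) h → h ≡ x ⊎ h ≡ y
headIsEndpoint (m-left _)    = inj₂ refl
headIsEndpoint (m-right _)   = inj₁ refl
headIsEndpoint (iso₁₂ _ _ _) = inj₂ refl
headIsEndpoint (iso₂₁ _ _ _) = inj₁ refl

crossingEndpointsDistinct : ∀ {N} {T : SYT3 N} {a b c d : ℕ} →
  Cross T (a , b) (c , d) → a ≢ b × c ≢ d
crossingEndpointsDistinct (_ , _ , a<c , c<b , b<d) =
  <⇒≢ (<-trans a<c c<b) , <⇒≢ (<-trans c<b b<d)

module GoodResolution (a b c d : ℕ) (a≢b : a ≢ b) (c≢d : c ≢ d) where
  b≢a : b ≢ a
  b≢a e = a≢b (sym e)

  d≢c : d ≢ c
  d≢c e = c≢d (sym e)

  -- α → a, β → c: out {h₁,h₂}, in {h₃,h₀}.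
  towards-a-c : ∃! _≡_ (Crossing.Good a b c d a c)
  towards-a-c =
    res p₁₂ B , (inj₁ (refl , refl , λ ()) , inj₂ (b≢a , d≢c , refl)) , unique
    where
    open Crossing a b c d a c
    unique : ∀ {r} → Good r → res p₁₂ B ≡ r
    unique {res p₀₁ _} (inj₁ (h₀-out , _) , _)     = ⊥-elim (d≢c h₀-out)
    unique {res p₀₁ _} (inj₂ (_ , h₁-in , _) , _)  = ⊥-elim (h₁-in refl)
    unique {res p₁₂ A} (inj₁ (_ , _ , A≢A) , _)    = ⊥-elim (A≢A refl)
    unique {res p₁₂ A} (inj₂ (h₁-in , _) , _)      = ⊥-elim (h₁-in refl)
    unique {res p₁₂ B} _                           = refl

  -- α → a, β → d: out {h₀,h₁}, in {h₂,h₃}.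
  towards-a-d : ∃! _≡_ (Crossing.Good a b c d a d)
  towards-a-d =
    res p₀₁ B , (inj₁ (refl , refl , λ ()) , inj₂ (c≢d , b≢a , refl)) , unique
    where
    open Crossing a b c d a d
    unique : ∀ {r} → Good r → res p₀₁ B ≡ r
    unique {res p₁₂ _} (inj₁ (_ , h₂-out , _) , _) = ⊥-elim (c≢d h₂-out)
    unique {res p₁₂ _} (inj₂ (h₁-in , _) , _)      = ⊥-elim (h₁-in refl)
    unique {res p₀₁ A} (inj₁ (_ , _ , A≢A) , _)    = ⊥-elim (A≢A refl)
    unique {res p₀₁ A} (inj₂ (h₀-in , _) , _)      = ⊥-elim (h₀-in refl)
    unique {res p₀₁ B} _                           = refl

  -- α → b, β → c: out {h₂,h₃}, in {h₀,h₁}.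
  towards-b-c : ∃! _≡_ (Crossing.Good a b c d b c)
  towards-b-c =
    res p₀₁ A , (inj₂ (d≢c , a≢b , refl) , inj₁ (refl , refl , λ ())) , unique
    where
    open Crossing a b c d b c
    unique : ∀ {r} → Good r → res p₀₁ A ≡ r
    unique {res p₁₂ _} (inj₁ (h₁-out , _) , _)     = ⊥-elim (a≢b h₁-out)
    unique {res p₁₂ _} (inj₂ (_ , h₂-in , _) , _)  = ⊥-elim (h₂-in refl)
    unique {res p₀₁ B} (inj₁ (h₀-out , _) , _)     = ⊥-elim (d≢c h₀-out)
    unique {res p₀₁ B} (inj₂ (_ , _ , ()) , _)
    unique {res p₀₁ A} _                           = refl

  -- α → b, β → d: out {h₃,h₀}, in {h₁,h₂}.
  towards-b-d : ∃! _≡_ (Crossing.Good a b c d b d)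
  towards-b-d =
    res p₁₂ A , (inj₂ (a≢b , c≢d , refl) , inj₁ (refl , refl , λ ())) , unique
    where
    open Crossing a b c d b d
    unique : ∀ {r} → Good r → res p₁₂ A ≡ r
    unique {res p₀₁ _} (inj₁ (_ , h₁-out , _) , _) = ⊥-elim (a≢b h₁-out)
    unique {res p₀₁ _} (inj₂ (h₀-in , _) , _)      = ⊥-elim (h₀-in refl)
    unique {res p₁₂ B} (inj₁ (h₃-out , _) , _)     = ⊥-elim (a≢b h₃-out)
    unique {res p₁₂ B} (inj₂ (_ , _ , ()) , _)
    unique {res p₁₂ A} _                           = refl

  uniqueGoodResolution : ∀ {hα hβ} → hα ≡ a ⊎ hα ≡ b → hβ ≡ c ⊎ hβ ≡ d →
    ∃! _≡_ (Crossing.Good a b c d hα hβ)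
  uniqueGoodResolution (inj₁ refl) (inj₁ refl) = towards-a-c
  uniqueGoodResolution (inj₁ refl) (inj₂ refl) = towards-a-d
  uniqueGoodResolution (inj₂ refl) (inj₁ refl) = towards-b-c
  uniqueGoodResolution (inj₂ refl) (inj₂ refl) = towards-b-d

lemma3p1 : ∀ {N} (T : SYT3 N) {a b c d hα hβ : ℕ} →
    Cross T (a , b) (c , d) → Head T (a , b) hα → Head T (c , d) hβ →
    ∃! _≡_ (Crossing.Good a b c d hα hβ)
lemma3p1 T {a} {b} {c} {d} crossing headα headβ
  with crossingEndpointsDistinct {T = T} crossing
... | a≢b , c≢d =
  GoodResolution.uniqueGoodResolution a b c d a≢b c≢d
    (headIsEndpoint headα) (headIsEndpoint headβ)
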